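{- Let $G=(V,E)$ be a connected simple graph with mixed metric dimension $\beta_M(G)$, diameter $D$ and maximum degree $\Delta(G)$. Then $|V|+|E|\leq D^{\beta_M(G)}+\beta_M(G)\,(\Delta(G)+1)$.
   Context: For vertices $u,v$, $d(u,v)$ is the number of edges on a shortest $u$–$v$ path. For a vertex $w$ and an edge $e=uv$, $d(w,e)=\min(d(w,u),d(w,v))$. A vertex $w$ resolves two elements $x,y\in V\cup E$ if $d(w,x)\neq d(w,y)$. A set $S\subseteq V$ is a mixed resolving set if every pair of distinct elements of $V\cup E$ is resolved by some element of $S$. The mixed metric dimension $\beta_M(G)$ is the minimum cardinality of a mixed resolving set of $G$. The diameter is $D=\max_{u,v\in V} d(u,v)$. -}

module Defs where

open import Data.Nat using (ℕ; zero; suc; _≤_; _<ᵇ_; _⊓_)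
open import Data.Fin using (Fin; toℕ)
open import Data.Fin.Subset using (Subset; ∣_∣; _∈_)
open import Data.Vec using (tabulate)
open import Data.List using (map; allFin)
open import Data.Nat.ListAction using (sum)
open import Data.Bool using (Bool; T; _∧_)
open import Data.Sum using (_⊎_; inj₁; inj₂)
open import Data.Product using (Σ; ∃; ∃-syntax; _×_; _,_; proj₁; proj₂)
open import Relation.Binary.PropositionalEquality using (_≡_; _≢_)

record Graph (n : ℕ) : Set where
  field
    adj     : Fin n → Fin n → Bool
    sym     : ∀ u v → adj u v ≡ adj v u
    irrefl  : ∀ u → adj u u ≡ Data.Bool.false

module _ {n : ℕ} (G : Graph n) where
  open Graph G

  data Walk : Fin n → Fin n → ℕ → Set where
    here : ∀ {u} → Walk u u zero
    step : ∀ {u w v k} → T (adj u w) → Walk w v k → Walk u v (suc k)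

  Connected : Set
  Connected = ∀ u v → ∃[ k ] Walk u v k

  Dist : Fin n → Fin n → ℕ → Set
  Dist u v k = Walk u v k × (∀ m → Walk u v m → k ≤ m)

  -- Edges: unordered pairs {u,v} represented by (u,v) with u < v
  Edge : Set
  Edge = Σ (Fin n × Fin n) λ p → T ((toℕ (proj₁ p) <ᵇ toℕ (proj₂ p)) ∧ adj (proj₁ p) (proj₂ p))

  Elem : Set
  Elem = Fin n ⊎ Edge

  DistElem : Fin n → Elem → ℕ → Set
  DistElem w (inj₁ v) k = Dist w v k
  DistElem w (inj₂ ((a , b) , _)) k =
    ∃[ ka ] ∃[ kb ] (Dist w a ka × Dist w b kb × k ≡ ka ⊓ kb)

  Resolves : Fin n → Elem → Elem → Set
  Resolves w x y = ∀ kx ky → DistElem w x kx → DistElem w y ky → kx ≢ ky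

  MixedResolving : Subset n → Set
  MixedResolving S = ∀ (x y : Elem) → x ≢ y → ∃[ w ] (w ∈ S × Resolves w x y)

  IsMixedMetricDim : ℕ → Set
  IsMixedMetricDim β =
    (∃[ S ] (MixedResolving S × ∣ S ∣ ≡ β)) × (∀ S → MixedResolving S → β ≤ ∣ S ∣)

  IsDiameter : ℕ → Set
  IsDiameter D = (∃[ u ] ∃[ v ] Dist u v D) × (∀ u v k → Dist u v k → k ≤ D)

  degree : Fin n → ℕ
  degree v = ∣ tabulate (adj v) ∣

  IsMaxDegree : ℕ → Set
  IsMaxDegree Δ = (∃[ v ] degree v ≡ Δ) × (∀ v → degree v ≤ Δ)

  edgeCount : ℕ
  edgeCount = sum (map (λ u → ∣ tabulate (λ v → (toℕ u <ᵇ toℕ v) ∧ adj u v) ∣) (allFin n))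

-- Fix a mixed resolving set S = {w₁,…,w_β} of a connected graph G with
-- diameter D and maximum degree Δ.  Split V ∪ E into two parts:
--   * the elements at distance 0 from some wᵢ, i.e. the vertex wᵢ itself or
--     an edge incident to wᵢ; the "star" of wᵢ has at most Δ + 1 elements,
--     so this part has at most β (Δ + 1) elements;
--   * the remaining elements x, whose distance vector (d(w₁,x),…,d(w_β,x))
--     lies in {1,…,D}^β; since S is resolving this vector determines x,
--     so this part has at most D^β elements.
module Submission where

open import Defs
open import Data.Nat using (ℕ; zero; suc; _+_; _*_; _^_; _≤_; _⊓_; _<ᵇ_; z≤n; s≤s; _≟_)
open import Data.Nat.Properties
  using (+-suc; +-comm; +-mono-≤; ≤-trans; <-asym; <ᵇ⇒<; m⊓n≤m)
open import Data.Fin as Fin using (Fin; toℕ)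
open import Data.Fin.Subset using (Subset; ∣_∣)
import Data.Fin.Properties as FinP
open import Data.Vec as Vec using (Vec; lookup; tabulate)
open import Data.Vec.Properties using (lookup∘tabulate; []=⇒lookup)
open import Data.List using (List; []; _∷_; _++_; map; length; allFin; filter; upTo; cartesianProductWith)
open import Data.List.Properties using (length-++; length-map; length-tabulate; length-upTo; ∷-injective)
open import Data.Nat.ListAction using (sum)
open import Data.List.Membership.Propositional using (_∈_)
open import Data.List.Membership.Propositional.Properties
  using (∈-map⁺; ∈-map⁻; ∈-++⁺ˡ; ∈-++⁺ʳ; ∈-++⁻; ∈-filter⁻; ∈-upTo⁺; ∈-cartesianProductWith⁺)
open import Data.List.Relation.Unary.Any using (Any; here; there; any?)
open import Data.List.Relation.Unary.All as All using (All; []; _∷_)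
open import Data.List.Relation.Unary.AllPairs using ([]; _∷_)
open import Data.List.Relation.Unary.Unique.Propositional using (Unique)
import Data.List.Relation.Unary.Unique.Propositional.Properties as Unique
open import Data.Bool using (Bool; true; false; T; _∧_; if_then_else_)
open import Data.Bool.Properties using (T-≡; T-∧)
open import Data.Sum using (_⊎_; inj₁; inj₂)
open import Data.Product using (∃-syntax; _×_; _,_; proj₁; proj₂)
open import Data.Unit using (⊤; tt)
open import Data.Empty using (⊥-elim)
open import Function.Bundles using (Equivalence)
open import Relation.Nullary using (¬_; Dec; yes; no; ¬?)
open import Relation.Nullary.Decidable using (T?; _×-dec_)
open import Relation.Binary.PropositionalEquality

open Equivalence using (to; from)

private
  remove : ∀ {A : Set} {x : A} (ys : List A) → x ∈ ys → List A
  remove (y ∷ ys) (here _)  = ys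
  remove (y ∷ ys) (there p) = y ∷ remove ys p

  length-remove : ∀ {A : Set} {x : A} (ys : List A) (p : x ∈ ys) → suc (length (remove ys p)) ≡ length ys
  length-remove (y ∷ ys) (here _)  = refl
  length-remove (y ∷ ys) (there p) = cong suc (length-remove ys p)

  ∈-remove : ∀ {A : Set} {x y : A} (ys : List A) (p : x ∈ ys) → y ∈ ys → y ≢ x → y ∈ remove ys p
  ∈-remove (z ∷ ys) (here refl) (here refl) y≢x = ⊥-elim (y≢x refl)
  ∈-remove (z ∷ ys) (here refl) (there q)   _   = q
  ∈-remove (z ∷ ys) (there p)   (here e)    _   = here e
  ∈-remove (z ∷ ys) (there p)   (there q)   y≢x = there (∈-remove ys p q y≢x)

module _ {A : Set} where

  injection-length≤ : ∀ {B : Set} (f : A → B) (xs : List A) (ys : List B) → Unique xs →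
    (∀ {x y} → x ∈ xs → y ∈ xs → x ≢ y → f x ≢ f y) →
    (∀ {x} → x ∈ xs → f x ∈ ys) → length xs ≤ length ys
  injection-length≤ f []       ys _          _   _    = z≤n
  injection-length≤ f (x ∷ xs) ys (x∉xs ∷ u) inj into =
    subst (suc (length xs) ≤_) (length-remove ys fx∈ys)
      (s≤s (injection-length≤ f xs (remove ys fx∈ys) u
        (λ y∈ z∈ → inj (there y∈) (there z∈))
        (λ y∈ → ∈-remove ys fx∈ys (into (there y∈))
                  (λ fy≡fx → inj (here refl) (there y∈) (All.lookup x∉xs y∈) (sym fy≡fx)))))
    where
    fx∈ys = into (here refl)

  length-filter-split : ∀ {P : A → Set} (P? : ∀ x → Dec (P x)) (xs : List A) →
    length xs ≡ length (filter P? xs) + length (filter (λ x → ¬? (P? x)) xs)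
  length-filter-split P? [] = refl
  length-filter-split P? (x ∷ xs) with P? x
  ... | yes _ = cong suc (length-filter-split P? xs)
  ... | no  _ = trans (cong suc (length-filter-split P? xs)) (sym (+-suc _ _))

  map-≡⇒pointwise : ∀ {B : Set} (f g : A → B) (us : List A) → map f us ≡ map g us →
    ∀ {w} → w ∈ us → f w ≡ g w
  map-≡⇒pointwise f g (u ∷ us) e (here refl) = proj₁ (∷-injective e)
  map-≡⇒pointwise f g (u ∷ us) e (there m)   = map-≡⇒pointwise f g us (proj₂ (∷-injective e)) m

  ∈⇒Any : ∀ {P : A → Set} {w : A} {us : List A} → w ∈ us → P w → Any P us
  ∈⇒Any (here refl) p = here p
  ∈⇒Any (there m)   p = there (∈⇒Any m p)

members : ∀ {k} → Vec Bool k → List (Fin k)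
members Vec.[]           = []
members (true  Vec.∷ bs) = Fin.zero ∷ map Fin.suc (members bs)
members (false Vec.∷ bs) = map Fin.suc (members bs)

length-members : ∀ {k} (p : Vec Bool k) → length (members p) ≡ ∣ p ∣
length-members Vec.[]           = refl
length-members (true  Vec.∷ bs) = cong suc (trans (length-map Fin.suc (members bs)) (length-members bs))
length-members (false Vec.∷ bs) = trans (length-map Fin.suc (members bs)) (length-members bs)

members⁺ : ∀ {k} (p : Vec Bool k) (i : Fin k) → lookup p i ≡ true → i ∈ members p
members⁺ (true  Vec.∷ bs) Fin.zero    _  = here refl
members⁺ (true  Vec.∷ bs) (Fin.suc i) e  = there (∈-map⁺ Fin.suc (members⁺ bs i e))
members⁺ (false Vec.∷ bs) (Fin.suc i) e  = ∈-map⁺ Fin.suc (members⁺ bs i e)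

members⁻ : ∀ {k} (p : Vec Bool k) (i : Fin k) → i ∈ members p → lookup p i ≡ true
members⁻ (true Vec.∷ bs) Fin.zero    _          = refl
members⁻ (true Vec.∷ bs) (Fin.suc i) (there m) with ∈-map⁻ Fin.suc m
... | j , j∈ , refl = members⁻ bs j j∈
members⁻ (false Vec.∷ bs) i m with ∈-map⁻ Fin.suc m
... | j , j∈ , refl = members⁻ bs j j∈

members-unique : ∀ {k} (p : Vec Bool k) → Unique (members p)
members-unique Vec.[]           = []
members-unique (true  Vec.∷ bs) = zero∉ (members bs) ∷ Unique.map⁺ FinP.suc-injective (members-unique bs)
  where
  zero∉ : ∀ {k} (xs : List (Fin k)) → All (Fin.zero ≢_) (map Fin.suc xs)
  zero∉ []       = []
  zero∉ (x ∷ xs) = (λ ()) ∷ zero∉ xs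
members-unique (false Vec.∷ bs) = Unique.map⁺ FinP.suc-injective (members-unique bs)

members-tabulate⁺ : ∀ {k} (f : Fin k → Bool) {i} → T (f i) → i ∈ members (tabulate f)
members-tabulate⁺ f {i} t = members⁺ (tabulate f) i (trans (lookup∘tabulate f i) (to T-≡ t))

members-tabulate⁻ : ∀ {k} (f : Fin k → Bool) {i} → i ∈ members (tabulate f) → T (f i)
members-tabulate⁻ f {i} m = from T-≡ (trans (sym (lookup∘tabulate f i)) (members⁻ (tabulate f) i m))

codeSpace : ℕ → ℕ → List (List ℕ)
codeSpace D zero    = [] ∷ []
codeSpace D (suc k) = cartesianProductWith _∷_ (map suc (upTo D)) (codeSpace D k)

length-cartesianProductWith : ∀ {A B C : Set} (f : A → B → C) xs ys →
  length (cartesianProductWith f xs ys) ≡ length xs * length ys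
length-cartesianProductWith f []       ys = refl
length-cartesianProductWith f (x ∷ xs) ys =
  trans (length-++ (map (f x) ys))
        (cong₂ _+_ (length-map (f x) ys) (length-cartesianProductWith f xs ys))

length-codeSpace : ∀ D k → length (codeSpace D k) ≡ D ^ k
length-codeSpace D zero    = refl
length-codeSpace D (suc k) =
  trans (length-cartesianProductWith _∷_ (map suc (upTo D)) (codeSpace D k))
        (cong₂ _*_ (trans (length-map suc (upTo D)) (length-upTo D)) (length-codeSpace D k))

map∈codeSpace : ∀ {A : Set} D (g : A → ℕ) (us : List A) →
  (∀ {u} → u ∈ us → g u ≢ 0 × g u ≤ D) → map g us ∈ codeSpace D (length us)
map∈codeSpace D g []       _     = here refl
map∈codeSpace D g (u ∷ us) range =
  ∈-cartesianProductWith⁺ _∷_ (entry (g u) (range (here refl)))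
    (map∈codeSpace D g us (λ m → range (there m)))
  where
  entry : ∀ e → e ≢ 0 × e ≤ D → e ∈ map suc (upTo D)
  entry zero    (e≢0 , _)   = ⊥-elim (e≢0 refl)
  entry (suc e) (_   , e<D) = ∈-map⁺ suc (∈-upTo⁺ e<D)

minimise : ∀ {P : ℕ → Set} → (∀ m → Dec (P m)) → ∀ k → P k →
  ∃[ m ] (P m × (∀ j → P j → m ≤ j))
minimise P? zero p0 = zero , p0 , λ _ _ → z≤n
minimise {P} P? (suc k) pk with P? zero
... | yes p0 = zero , p0 , λ _ _ → z≤n
... | no ¬p0 with minimise {λ m → P (suc m)} (λ m → P? (suc m)) k pk
... | m , pm , least = suc m , pm , below
  where
  below : ∀ j → P j → suc m ≤ j
  below zero    p0 = ⊥-elim (¬p0 p0)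
  below (suc j) pj = s≤s (least j pj)

module _ {n : ℕ} (G : Graph n) where
  open Graph G using (adj)

  walk? : ∀ m u v → Dec (Walk G u v m)
  walk? zero u v with u FinP.≟ v
  ... | yes refl = yes here
  ... | no  u≢v  = no λ { here → u≢v refl }
  walk? (suc m) u v with FinP.any? (λ w → T? (adj u w) ×-dec walk? m w v)
  ... | yes (w , a , p) = yes (step a p)
  ... | no  ¬first      = no λ { (step a p) → ¬first (_ , a , p) }

  distance : Connected G → ∀ u v → ∃[ k ] Dist G u v k
  distance conn u v = minimise (λ m → walk? m u v) (proj₁ (conn u v)) (proj₂ (conn u v))

  walk-length-0 : ∀ {w v k} → Walk G w v k → k ≡ 0 → w ≡ v
  walk-length-0 here refl = refl

  -- A vertex, or an ordered pair of vertices; a pair (a , b) stands for an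
  -- edge when it is Valid, i.e. a < b and a ~ b.
  RawElem : Set
  RawElem = Fin n ⊎ (Fin n × Fin n)

  isEdge : Fin n → Fin n → Bool
  isEdge u v = (toℕ u <ᵇ toℕ v) ∧ adj u v

  isEdge-ordered : ∀ a b → T (isEdge a b) → T (toℕ a <ᵇ toℕ b)
  isEdge-ordered a b t = proj₁ (to (T-∧ {toℕ a <ᵇ toℕ b} {adj a b}) t)

  isEdge-adjacent : ∀ a b → T (isEdge a b) → T (adj a b)
  isEdge-adjacent a b t = proj₂ (to (T-∧ {toℕ a <ᵇ toℕ b} {adj a b}) t)

  Valid : RawElem → Set
  Valid (inj₁ _)       = ⊤
  Valid (inj₂ (a , b)) = T (isEdge a b)

  toElem : (x : RawElem) → Valid x → Elem G
  toElem (inj₁ v)       _ = inj₁ v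
  toElem (inj₂ (a , b)) t = inj₂ ((a , b) , t)

  toElem-injective : ∀ x y vx vy → toElem x vx ≡ toElem y vy → x ≡ y
  toElem-injective (inj₁ v)       (inj₁ .v)        _ _ refl = refl
  toElem-injective (inj₂ (a , b)) (inj₂ (.a , .b)) _ _ refl = refl

  edgesFrom : List (Fin n) → List (Fin n × Fin n)
  edgesFrom []       = []
  edgesFrom (u ∷ us) = map (u ,_) (members (tabulate (isEdge u))) ++ edgesFrom us

  length-edgesFrom : ∀ us → length (edgesFrom us) ≡ sum (map (λ u → ∣ tabulate (isEdge u) ∣) us)
  length-edgesFrom []       = refl
  length-edgesFrom (u ∷ us) =
    trans (length-++ (map (u ,_) row))
          (cong₂ _+_ (trans (length-map (u ,_) row) (length-members (tabulate (isEdge u))))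
                     (length-edgesFrom us))
    where row = members (tabulate (isEdge u))

  ∈-edgesFrom⁻ : ∀ us {e} → e ∈ edgesFrom us → proj₁ e ∈ us × T (isEdge (proj₁ e) (proj₂ e))
  ∈-edgesFrom⁻ (u ∷ us) m with ∈-++⁻ (map (u ,_) (members (tabulate (isEdge u)))) m
  ... | inj₂ m′ = there (proj₁ (∈-edgesFrom⁻ us m′)) , proj₂ (∈-edgesFrom⁻ us m′)
  ... | inj₁ m′ with ∈-map⁻ (u ,_) m′
  ... | v , v∈ , refl = here refl , members-tabulate⁻ (isEdge u) v∈

  edgesFrom-unique : ∀ us → Unique us → Unique (edgesFrom us)
  edgesFrom-unique []       _           = []
  edgesFrom-unique (u ∷ us) (u∉us ∷ uu) =
    Unique.++⁺ (Unique.map⁺ (λ { refl → refl }) (members-unique (tabulate (isEdge u))))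
               (edgesFrom-unique us uu) disjoint
    where
    disjoint : ∀ {e} → ¬ (e ∈ map (u ,_) (members (tabulate (isEdge u))) × e ∈ edgesFrom us)
    disjoint (m₁ , m₂) with ∈-map⁻ (u ,_) m₁
    ... | v , _ , refl = All.lookup u∉us (proj₁ (∈-edgesFrom⁻ us m₂)) refl

  elements : List RawElem
  elements = map inj₁ (allFin n) ++ map inj₂ (edgesFrom (allFin n))

  elements-unique : Unique elements
  elements-unique =
    Unique.++⁺ (Unique.map⁺ (λ { refl → refl }) (Unique.allFin⁺ n))
               (Unique.map⁺ (λ { refl → refl }) (edgesFrom-unique (allFin n) (Unique.allFin⁺ n)))
               disjoint
    where
    disjoint : ∀ {x} → ¬ (x ∈ map inj₁ (allFin n) × x ∈ map inj₂ (edgesFrom (allFin n)))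
    disjoint (m₁ , m₂) with ∈-map⁻ inj₁ m₁ | ∈-map⁻ inj₂ m₂
    ... | _ , _ , refl | _ , _ , ()

  elements-valid : ∀ {x} → x ∈ elements → Valid x
  elements-valid m with ∈-++⁻ (map inj₁ (allFin n)) m
  ... | inj₁ m₁ with ∈-map⁻ inj₁ m₁
  ...   | _ , _ , refl = tt
  elements-valid m | inj₂ m₂ with ∈-map⁻ inj₂ m₂
  ...   | _ , e∈ , refl = proj₂ (∈-edgesFrom⁻ (allFin n) e∈)

  length-elements : length elements ≡ n + edgeCount G
  length-elements =
    trans (length-++ (map inj₁ (allFin n)))
      (cong₂ _+_ (trans (length-map inj₁ (allFin n)) (length-tabulate (λ (i : Fin n) → i)))
                 (trans (length-map inj₂ (edgesFrom (allFin n))) (length-edgesFrom (allFin n))))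

  orient : Fin n → Fin n → Fin n × Fin n
  orient w v = if toℕ w <ᵇ toℕ v then (w , v) else (v , w)

  orient-lower : ∀ a b → T (isEdge a b) → orient a b ≡ (a , b)
  orient-lower a b t rewrite to T-≡ (isEdge-ordered a b t) = refl

  orient-upper : ∀ a b → T (isEdge a b) → orient b a ≡ (a , b)
  orient-upper a b t with toℕ b <ᵇ toℕ a in b<a
  ... | false = refl
  ... | true  = ⊥-elim (<-asym (<ᵇ⇒< (toℕ a) (toℕ b) (isEdge-ordered a b t))
                               (<ᵇ⇒< (toℕ b) (toℕ a) (subst T (sym b<a) tt)))

  incident : Fin n → List (Fin n × Fin n)
  incident w = map (orient w) (members (tabulate (adj w)))

  length-incident : ∀ w → length (incident w) ≡ degree G w
  length-incident w = trans (length-map (orient w) (members (tabulate (adj w)))) (length-members (tabulate (adj w)))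

  incident-lower : ∀ a b → T (isEdge a b) → (a , b) ∈ incident a
  incident-lower a b t = subst (_∈ incident a) (orient-lower a b t)
    (∈-map⁺ (orient a) (members-tabulate⁺ (adj a) (isEdge-adjacent a b t)))

  incident-upper : ∀ a b → T (isEdge a b) → (a , b) ∈ incident b
  incident-upper a b t = subst (_∈ incident b) (orient-upper a b t)
    (∈-map⁺ (orient b) (members-tabulate⁺ (adj b)
      (subst T (Graph.sym G a b) (isEdge-adjacent a b t))))

  stars : List (Fin n) → List RawElem
  stars []       = []
  stars (w ∷ ws) = (inj₁ w ∷ map inj₂ (incident w)) ++ stars ws

  length-stars : ∀ Δ → (∀ v → degree G v ≤ Δ) → ∀ ws → length (stars ws) ≤ length ws * suc Δ
  length-stars Δ deg []       = z≤n
  length-stars Δ deg (w ∷ ws) =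
    subst (_≤ suc Δ + length ws * suc Δ) (sym (length-++ (inj₁ w ∷ map inj₂ (incident w))))
      (+-mono-≤ (s≤s star≤) (length-stars Δ deg ws))
    where
    star≤ : length (map inj₂ (incident w)) ≤ Δ
    star≤ = subst (_≤ Δ) (sym (trans (length-map inj₂ (incident w)) (length-incident w))) (deg w)

  module _ (conn : Connected G) where

    dist : Fin n → Fin n → ℕ
    dist u v = proj₁ (distance conn u v)

    dist-0 : ∀ {w v} → dist w v ≡ 0 → w ≡ v
    dist-0 {w} {v} = walk-length-0 (proj₁ (proj₂ (distance conn w v)))

    distElem : Fin n → RawElem → ℕ
    distElem w (inj₁ v)       = dist w v
    distElem w (inj₂ (a , b)) = dist w a ⊓ dist w b

    distElem-correct : ∀ w x vx → DistElem G w (toElem x vx) (distElem w x)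
    distElem-correct w (inj₁ v)       _ = proj₂ (distance conn w v)
    distElem-correct w (inj₂ (a , b)) _ =
      dist w a , dist w b , proj₂ (distance conn w a) , proj₂ (distance conn w b) , refl

    distElem≤diameter : ∀ D → (∀ u v k → Dist G u v k → k ≤ D) → ∀ w x → distElem w x ≤ D
    distElem≤diameter D diam w (inj₁ v)       = diam w v _ (proj₂ (distance conn w v))
    distElem≤diameter D diam w (inj₂ (a , b)) =
      ≤-trans (m⊓n≤m (dist w a) (dist w b)) (diam w a _ (proj₂ (distance conn w a)))

    near⇒∈stars : ∀ ws x → Valid x → Any (λ w → distElem w x ≡ 0) ws → x ∈ stars ws
    near⇒∈stars (w ∷ ws) x vx (there near) =
      ∈-++⁺ʳ (inj₁ w ∷ map inj₂ (incident w)) (near⇒∈stars ws x vx near)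
    near⇒∈stars (w ∷ ws) (inj₁ v) _ (here d≡0) rewrite dist-0 d≡0 = here refl
    -- d(w , ab) = min(d(w,a), d(w,b)) = 0 forces w = a or w = b.
    near⇒∈stars (w ∷ ws) (inj₂ (a , b)) t (here d≡0) with dist w a | dist w b | dist-0 {w} {a} | dist-0 {w} {b}
    ... | zero  | _    | a≡w | _   rewrite a≡w refl = ∈-++⁺ˡ (there (∈-map⁺ inj₂ (incident-lower a b t)))
    ... | suc _ | zero | _   | b≡w rewrite b≡w refl = ∈-++⁺ˡ (there (∈-map⁺ inj₂ (incident-upper a b t)))

    mixedResolving-bound : ∀ (S : Subset n) → MixedResolving G S →
      ∀ D → (∀ u v k → Dist G u v k → k ≤ D) →
      ∀ Δ → (∀ v → degree G v ≤ Δ) →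
      n + edgeCount G ≤ D ^ ∣ S ∣ + ∣ S ∣ * suc Δ
    mixedResolving-bound S resolving D diam Δ deg =
      subst₂ (λ total k → total ≤ D ^ k + k * suc Δ)
        (trans (+-comm (length far) (length near))
               (trans (sym (length-filter-split near? elements)) length-elements))
        (length-members S)
        (+-mono-≤ far-bound near-bound)
      where
      ws : List (Fin n)
      ws = members S

      near? : ∀ x → Dec (Any (λ w → distElem w x ≡ 0) ws)
      near? x = any? (λ w → distElem w x ≟ 0) ws

      near far : List RawElem
      near = filter near? elements
      far  = filter (λ x → ¬? (near? x)) elements

      near-bound : length near ≤ length ws * suc Δ
      near-bound =
        ≤-trans (injection-length≤ (λ x → x) near (stars ws) (Unique.filter⁺ near? elements-unique)
                  (λ _ _ x≢y → x≢y)
                  (λ {x} m → let (x∈ , isNear) = ∈-filter⁻ near? {xs = elements} m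
                             in near⇒∈stars ws x (elements-valid x∈) isNear))
                (length-stars Δ deg ws)

      code : RawElem → List ℕ
      code x = map (λ w → distElem w x) ws

      code-separates : ∀ {x y} → x ∈ elements → y ∈ elements → x ≢ y → code x ≢ code y
      code-separates {x} {y} x∈ y∈ x≢y same =
        let vx = elements-valid x∈
            vy = elements-valid y∈
            (w , w∈S , resolves) = resolving (toElem x vx) (toElem y vy)
                                     (λ e → x≢y (toElem-injective x y vx vy e))
        in resolves (distElem w x) (distElem w y) (distElem-correct w x vx) (distElem-correct w y vy)
             (map-≡⇒pointwise _ _ ws same (members⁺ S w ([]=⇒lookup w∈S)))

      far-bound : length far ≤ D ^ length ws
      far-bound =
        subst (length far ≤_) (length-codeSpace D (length ws))
          (injection-length≤ code far (codeSpace D (length ws))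
            (Unique.filter⁺ (λ x → ¬? (near? x)) elements-unique)
            (λ x∈ y∈ → code-separates (in-elements x∈) (in-elements y∈))
            (λ {x} x∈ → map∈codeSpace D (λ w → distElem w x) ws
              (λ w∈ → (λ d≡0 → proj₂ (∈-filter⁻ (λ x → ¬? (near? x)) {xs = elements} x∈) (∈⇒Any w∈ d≡0))
                     , distElem≤diameter D diam _ x)))
        where
        in-elements : ∀ {x} → x ∈ far → x ∈ elements
        in-elements m = proj₁ (∈-filter⁻ (λ x → ¬? (near? x)) {xs = elements} m)

theorem4 : ∀ {n : ℕ} (G : Graph n) → Connected G →
    ∀ (β D Δ : ℕ) → IsMixedMetricDim G β → IsDiameter G D → IsMaxDegree G Δ →
    n + edgeCount G ≤ D ^ β + β * (Δ + 1)
theorem4 G conn β D Δ ((S , resolving , |S|≡β) , _) (_ , diam) (_ , deg)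
  rewrite +-comm Δ 1 | sym |S|≡β =
  mixedResolving-bound G conn S resolving D diam Δ deg
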